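{- Let $G$ be a graph with edge density $\epsilon=|E(G)|/|G|$ and chromatic number $\chi(G)$, and let $t\le 2\epsilon$ be a constant. Then every threshold assignment $\tau$ of $G$ with average threshold $t$ satisfies $dyn_\tau(G)\le |G|\big(1-\frac{1}{\chi(G)}\big)$; that is, $Dyn_{\bar t=t}(G)\le |G|(1-\frac{1}{\chi(G)})$.
   Context: Graphs are finite, undirected, simple. A threshold assignment for $G$ is a function $\tau:V(G)\to\mathbb{N}\cup\{0\}$ with $\tau(v)\le \deg(v)$ for every $v$; its average threshold is $\sum_{v}\tau(v)/|G|$. For $M\subseteq V(G)$, the $\tau$-dynamic process starting from $M$ is $D_0=M$ and, for $i\ge0$, $D_{i+1}$ = set of vertices $v\notin D_0\cup\dots\cup D_i$ with at least $\tau(v)$ neighbours in $D_0\cup\dots\cup D_i$; $M$ is a $\tau$-dynamic monopoly if $\bigcup_i D_i=V(G)$. $dyn_\tau(G)$ is the minimum size of a $\tau$-dynamic monopoly, and $Dyn_{\bar t=t}(G)$ is the maximum of $dyn_\tau(G)$ over threshold assignments $\tau$ with average threshold $t$. -}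

module Defs where

open import Data.Nat using (ℕ; zero; suc; _+_; _*_; _≤_; _<_; _<ᵇ_; _≤ᵇ_)
open import Data.Bool using (Bool; true; false; _∧_; _∨_)
open import Data.Fin using (Fin; toℕ)
open import Data.Fin.Subset using (Subset; ∣_∣; _∩_; ⊤)
open import Data.Vec using (tabulate; lookup; sum)
open import Data.Product using (Σ; _×_)
open import Relation.Binary.PropositionalEquality using (_≡_; _≢_)
open import Relation.Nullary using (¬_)

record Graph (n : ℕ) : Set where
  field
    adj    : Fin n → Fin n → Bool
    sym    : ∀ u v → adj u v ≡ adj v u
    irrefl : ∀ v → adj v v ≡ false
open Graph public

neighbours : ∀ {n} → Graph n → Fin n → Subset n
neighbours G v = tabulate (adj G v)

deg : ∀ {n} → Graph n → Fin n → ℕ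
deg G v = ∣ neighbours G v ∣

-- |E(G)|: number of unordered pairs {u,v} (counted with toℕ u < toℕ v) that are adjacent
edgeCount : ∀ {n} → Graph n → ℕ
edgeCount {n} G = sum (tabulate λ u → ∣ tabulate (λ v → (toℕ u <ᵇ toℕ v) ∧ adj G u v) ∣)

IsThresholdAssignment : ∀ {n} → Graph n → (Fin n → ℕ) → Set
IsThresholdAssignment G τ = ∀ v → τ v ≤ deg G v

-- sum of thresholds (average threshold = thresholdSum / |G|)
thresholdSum : ∀ {n} → (Fin n → ℕ) → ℕ
thresholdSum τ = sum (tabulate τ)

step : ∀ {n} → Graph n → (Fin n → ℕ) → Subset n → Subset n
step G τ S = tabulate λ v → lookup S v ∨ (τ v ≤ᵇ ∣ neighbours G v ∩ S ∣)

activated : ∀ {n} → Graph n → (Fin n → ℕ) → Subset n → ℕ → Subset n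
activated G τ M zero    = M
activated G τ M (suc i) = step G τ (activated G τ M i)

IsDynamicMonopoly : ∀ {n} → Graph n → (Fin n → ℕ) → Subset n → Set
IsDynamicMonopoly G τ M = Σ ℕ λ i → activated G τ M i ≡ ⊤

ProperColouring : ∀ {n} → Graph n → ℕ → Set
ProperColouring {n} G k =
  Σ (Fin n → Fin k) λ c → ∀ u v → adj G u v ≡ true → c u ≢ c v

IsChromaticNumber : ∀ {n} → Graph n → ℕ → Set
IsChromaticNumber G k = ProperColouring G k × (∀ j → j < k → ¬ ProperColouring G j)

-- Take a largest colour class I of a proper χ-colouring; it has at least n/χ
-- vertices. Since I is independent, every neighbour of a vertex of I lies
-- outside I, so starting from the complement of I each vertex v of I already
-- sees deg v ≥ τ v active neighbours and becomes active after one round.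
-- Hence the complement of I is a dynamic monopoly of size at most n(1 - 1/χ),
-- whatever the average threshold.
module Submission where

open import Defs
open import Data.Nat using (ℕ; zero; suc; _+_; _*_; _∸_; _≤_; _≤ᵇ_)
open import Data.Nat.Properties
  using (≤-refl; ≤-trans; ≤-reflexive; <⇒≤; ≰⇒>; _≤?_; +-mono-≤; +-monoʳ-≤; *-monoʳ-≤;
         *-comm; *-identityʳ; *-distribʳ-∸; *-distribˡ-∸; ∸-monoʳ-≤; ≤⇒≤ᵇ;
         +-0-commutativeMonoid; module ≤-Reasoning)
open import Data.Bool using (Bool; true; false; if_then_else_; _∨_)
open import Data.Bool.Properties using (∨-zeroʳ; T-≡)
open import Data.Fin using (Fin; zero; suc; punchIn; fromℕ<; _≟_)
open import Data.Fin.Properties using (punchInᵢ≢i)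
open import Data.Fin.Subset using (Subset; ∣_∣; _∈_; _⊆_; _∩_; ∁; ⊤)
open import Data.Fin.Subset.Properties
  using (_∈?_; ⊆-antisym; ⊆⊤; x∈p∩q⁺; x∉p⇒x∈∁p; p⊆q⇒∣p∣≤∣q∣; ∣∁p∣≡n∸∣p∣)
open import Data.Vec using (_∷_; tabulate; lookup)
open import Data.Vec.Properties using (lookup∘tabulate; lookup⇒[]=; []=⇒lookup)
open import Data.Product using (Σ; ∃; _×_; _,_)
open import Data.Sum using (_⊎_; inj₁; inj₂)
open import Function using (_∘_; Equivalence)
open import Relation.Nullary using (yes; no; does; proof)
open import Relation.Nullary.Reflects using (Reflects; invert)
open import Relation.Nullary.Decidable using (dec-true; dec-false)
open import Relation.Binary.PropositionalEquality
  using (_≡_; refl; trans; cong; cong₂; subst; module ≡-Reasoning) renaming (sym to ≡-sym)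
open import Algebra.Properties.CommutativeMonoid.Sum +-0-commutativeMonoid
  using (sum; sum-syntax; sum-cong-≗; sum-remove; sum-replicate-zero; ∑-distrib-+)

private
  variable
    n k : ℕ

∈-tabulate⁺ : {f : Fin n → Bool} {v : Fin n} → f v ≡ true → v ∈ tabulate f
∈-tabulate⁺ {f = f} {v} fv = lookup⇒[]= v (tabulate f) (trans (lookup∘tabulate f v) fv)

∈-tabulate⁻ : {f : Fin n → Bool} {v : Fin n} → v ∈ tabulate f → f v ≡ true
∈-tabulate⁻ {f = f} {v} v∈ = trans (≡-sym (lookup∘tabulate f v)) ([]=⇒lookup v∈)

∈-step⁺ : (G : Graph n) (τ : Fin n → ℕ) {S : Subset n} {v : Fin n} →
  v ∈ S ⊎ τ v ≤ ∣ neighbours G v ∩ S ∣ → v ∈ step G τ S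
∈-step⁺ G τ {S} {v} (inj₁ v∈S) =
  ∈-tabulate⁺ (cong (_∨ (τ v ≤ᵇ ∣ neighbours G v ∩ S ∣)) ([]=⇒lookup v∈S))
∈-step⁺ G τ {S} {v} (inj₂ τv≤) =
  ∈-tabulate⁺ (trans (cong (lookup S v ∨_) (Equivalence.to T-≡ (≤⇒≤ᵇ τv≤))) (∨-zeroʳ _))

IsIndependent : Graph n → Subset n → Set
IsIndependent G I = ∀ {u v} → u ∈ I → v ∈ I → adj G u v ≡ false

neighbours-⊆-∁ : (G : Graph n) {I : Subset n} → IsIndependent G I →
  {v : Fin n} → v ∈ I → neighbours G v ⊆ ∁ I
neighbours-⊆-∁ G {I} indep v∈I {u} u∈N with u ∈? I
... | no u∉I = x∉p⇒x∈∁p u∉I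
... | yes u∈I with () ← trans (≡-sym (indep v∈I u∈I)) (∈-tabulate⁻ u∈N)

∁-independent-step≡⊤ : (G : Graph n) (τ : Fin n → ℕ) → IsThresholdAssignment G τ →
  {I : Subset n} → IsIndependent G I → step G τ (∁ I) ≡ ⊤
∁-independent-step≡⊤ G τ thr {I} indep = ⊆-antisym ⊆⊤ (λ {v} _ → ∈-step⁺ G τ (entersStep v))
  where
  entersStep : ∀ v → v ∈ ∁ I ⊎ τ v ≤ ∣ neighbours G v ∩ ∁ I ∣
  entersStep v with v ∈? I
  ... | no v∉I = inj₁ (x∉p⇒x∈∁p v∉I)
  ... | yes v∈I = inj₂ (≤-trans (thr v) (p⊆q⇒∣p∣≤∣q∣ λ u∈N →
                    x∈p∩q⁺ (u∈N , neighbours-⊆-∁ G indep v∈I u∈N)))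

∁-independent-isDynamicMonopoly : (G : Graph n) (τ : Fin n → ℕ) → IsThresholdAssignment G τ →
  {I : Subset n} → IsIndependent G I → IsDynamicMonopoly G τ (∁ I)
∁-independent-isDynamicMonopoly G τ thr indep = 1 , ∁-independent-step≡⊤ G τ thr indep

colourClass : (Fin n → Fin k) → Fin k → Subset n
colourClass c j = tabulate (λ v → does (c v ≟ j))

∈-colourClass⁻ : (c : Fin n → Fin k) (j : Fin k) {v : Fin n} → v ∈ colourClass c j → c v ≡ j
∈-colourClass⁻ c j {v} v∈ = invert (subst (Reflects (c v ≡ j)) (∈-tabulate⁻ v∈) (proof (c v ≟ j)))

colourClass-isIndependent : (G : Graph n) ((c , proper) : ProperColouring G k) (j : Fin k) →
  IsIndependent G (colourClass c j)
colourClass-isIndependent G (c , proper) j {u} {v} u∈ v∈ with adj G u v in uv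
... | false = refl
... | true with () ← proper u v uv (trans (∈-colourClass⁻ c j u∈) (≡-sym (∈-colourClass⁻ c j v∈)))

indicator : Bool → ℕ
indicator b = if b then 1 else 0

∣∷∣ : (b : Bool) (p : Subset n) → ∣ b ∷ p ∣ ≡ indicator b + ∣ p ∣
∣∷∣ true  p = refl
∣∷∣ false p = refl

∑-indicator-≟ : (i : Fin k) → ∑[ j < k ] indicator (does (i ≟ j)) ≡ 1
∑-indicator-≟ {suc k} i = begin
  sum t                                ≡⟨ sum-remove {i = i} t ⟩
  t i + sum (t ∘ punchIn i)            ≡⟨ cong₂ _+_ (cong indicator (dec-true (i ≟ i) refl))
                                                    (sum-cong-≗ λ j → cong indicator
                                                      (dec-false (i ≟ punchIn i j) (punchInᵢ≢i i j ∘ ≡-sym))) ⟩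
  1 + sum (λ (_ : Fin k) → 0)          ≡⟨ cong (1 +_) (sum-replicate-zero k) ⟩
  1                                    ∎
  where
  open ≡-Reasoning
  t : Fin (suc k) → ℕ
  t j = indicator (does (i ≟ j))

∑-∣colourClass∣ : (c : Fin n → Fin k) → ∑[ j < k ] ∣ colourClass c j ∣ ≡ n
∑-∣colourClass∣ {zero}  {k} c = sum-replicate-zero k
∑-∣colourClass∣ {suc n} {k} c = begin
  sum (λ j → ∣ colourClass c j ∣)
    ≡⟨ sum-cong-≗ (λ j → ∣∷∣ (does (c zero ≟ j)) (colourClass (c ∘ suc) j)) ⟩
  sum (λ j → indicator (does (c zero ≟ j)) + ∣ colourClass (c ∘ suc) j ∣)
    ≡⟨ ∑-distrib-+ (λ j → indicator (does (c zero ≟ j))) (λ j → ∣ colourClass (c ∘ suc) j ∣) ⟩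
  sum (λ j → indicator (does (c zero ≟ j))) + sum (λ j → ∣ colourClass (c ∘ suc) j ∣)
    ≡⟨ cong₂ _+_ (∑-indicator-≟ (c zero)) (∑-∣colourClass∣ (c ∘ suc)) ⟩
  suc n ∎
  where open ≡-Reasoning

∃-largest-summand : (f : Fin (suc k) → ℕ) → ∃ λ j → sum f ≤ suc k * f j
∃-largest-summand {zero}  f = zero , ≤-refl
∃-largest-summand {suc k} f with j , h ← ∃-largest-summand (f ∘ suc) | f zero ≤? f (suc j)
... | yes f₀≤fⱼ = suc j , +-mono-≤ f₀≤fⱼ h
... | no  f₀≰fⱼ = zero , +-monoʳ-≤ (f zero) (≤-trans h (*-monoʳ-≤ (suc k) (<⇒≤ (≰⇒> f₀≰fⱼ))))

∃-large-colourClass : (c : Fin n → Fin (suc k)) → ∃ λ j → n ≤ suc k * ∣ colourClass c j ∣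
∃-large-colourClass {k = k} c with j , h ← ∃-largest-summand (λ j → ∣ colourClass c j ∣) =
  j , subst (_≤ suc k * ∣ colourClass c j ∣) (∑-∣colourClass∣ c) h

n≤k*a⇒[n∸a]*k≤n*[k∸1] : ∀ {a} k → n ≤ k * a → (n ∸ a) * k ≤ n * (k ∸ 1)
n≤k*a⇒[n∸a]*k≤n*[k∸1] {n} {a} k n≤k*a = begin
  (n ∸ a) * k   ≡⟨ *-distribʳ-∸ k n a ⟩
  n * k ∸ a * k ≤⟨ ∸-monoʳ-≤ (n * k) (≤-trans n≤k*a (≤-reflexive (*-comm k a))) ⟩
  n * k ∸ n     ≡⟨ cong (n * k ∸_) (≡-sym (*-identityʳ n)) ⟩
  n * k ∸ n * 1 ≡⟨ *-distribˡ-∸ n k 1 ⟨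
  n * (k ∸ 1)   ∎
  where open ≤-Reasoning

corollary3 : ∀ {n} (G : Graph n) (χ : ℕ) → 1 ≤ n → IsChromaticNumber G χ →
    (τ : Fin n → ℕ) → IsThresholdAssignment G τ →
    thresholdSum τ ≤ 2 * edgeCount G →
    Σ (Subset n) λ M → IsDynamicMonopoly G τ M × ∣ M ∣ * χ ≤ n * (χ ∸ 1)
corollary3 G zero 1≤n ((c , _) , _) _ _ _ with () ← c (fromℕ< 1≤n)
corollary3 {n} G (suc k) _ (colouring@(c , _) , _) τ thr _ with j , n≤ ← ∃-large-colourClass c =
  ∁ I , ∁-independent-isDynamicMonopoly G τ thr (colourClass-isIndependent G colouring j) , size
  where
  I : Subset n
  I = colourClass c j
  size : ∣ ∁ I ∣ * suc k ≤ n * k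
  size = subst (λ m → m * suc k ≤ n * k) (≡-sym (∣∁p∣≡n∸∣p∣ I)) (n≤k*a⇒[n∸a]*k≤n*[k∸1] (suc k) n≤)
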